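{- Let $\alpha,\beta,\gamma,\delta$ be real numbers and consider the system of inequalities in real variables $x,y$: (1) $2x+y\leq\alpha$; (2) $x+2y\leq\beta$; (3) $x+y\geq\gamma$; (4) $x+y\leq\delta$. This system has a solution with $x,y\geq 0$ if and only if $\alpha,\beta,\delta\geq 0$, $\gamma\leq\alpha$, $\gamma\leq\beta$, $\gamma\leq\delta$, and $\alpha+\beta\geq 3\gamma$. Further, if $\alpha,\beta,\gamma$ are rational and such a solution exists, then there is such a solution with $x,y$ rational. -}

module Defs where

open import Level using (0ℓ)
open import Data.Nat using (ℕ; zero; suc)
open import Data.Integer using (ℤ; +_; -[1+_])
open import Data.Product using (Σ; ∃; ∃₂; _×_; _,_)
open import Relation.Nullary using (¬_)
open import Relation.Binary.PropositionalEquality using (_≡_)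
open import Relation.Binary.Structures using (IsTotalOrder)
open import Algebra.Structures using (IsCommutativeRing)

-- The real numbers, given axiomatically as a complete ordered field
-- (agda-stdlib has no real numbers).  Any model of these axioms is
-- (classically) isomorphic to ℝ.
record RealNumbers : Set₁ where
  infixl 6 _+_
  infixl 7 _*_
  infix  4 _≤_
  field
    Carrier : Set
    _+_ _*_ : Carrier → Carrier → Carrier
    -_      : Carrier → Carrier
    0# 1#   : Carrier
    _≤_     : Carrier → Carrier → Set
    isCommutativeRing : IsCommutativeRing _≡_ _+_ _*_ -_ 0# 1#
    0≢1     : ¬ (0# ≡ 1#)
    inverse : ∀ x → ¬ (x ≡ 0#) → ∃ λ y → x * y ≡ 1#
    isTotalOrder : IsTotalOrder _≡_ _≤_
    +-mono-≤  : ∀ {x y} z → x ≤ y → x + z ≤ y + z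
    *-nonneg  : ∀ {x y} → 0# ≤ x → 0# ≤ y → 0# ≤ x * y
    completeness : (P : Carrier → Set) → (∃ λ x → P x) →
                   (∃ λ b → ∀ x → P x → x ≤ b) →
                   ∃ λ s → (∀ x → P x → x ≤ s) ×
                           (∀ b → (∀ x → P x → x ≤ b) → s ≤ b)

  fromℕ : ℕ → Carrier
  fromℕ zero    = 0#
  fromℕ (suc n) = 1# + fromℕ n

  fromℤ : ℤ → Carrier
  fromℤ (+ n)      = fromℕ n
  fromℤ -[1+ n ]   = - fromℕ (suc n)

  -- r is a rational number: r = p / (n+1) for some p ∈ ℤ, n ∈ ℕ
  IsRational : Carrier → Set
  IsRational r = ∃₂ λ (p : ℤ) (n : ℕ) → fromℕ (suc n) * r ≡ fromℤ p

module _ (R : RealNumbers) where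
  open RealNumbers R

  System : (α β γ δ x y : Carrier) → Set
  System α β γ δ x y =
    (fromℕ 2 * x + y ≤ α) × (x + fromℕ 2 * y ≤ β) ×
    (γ ≤ x + y) × (x + y ≤ δ) × (0# ≤ x) × (0# ≤ y)

  Condition : (α β γ δ : Carrier) → Set
  Condition α β γ δ =
    (0# ≤ α) × (0# ≤ β) × (0# ≤ δ) × (γ ≤ α) × (γ ≤ β) × (γ ≤ δ) ×
    (fromℕ 3 * γ ≤ α + β)

{-# OPTIONS --safe #-}

-- Both directions are certificates of linear arithmetic over an ordered
-- ring: the slack (right side minus left side) of every condition is a sum
-- of slacks of the system, including x ≥ 0 and y ≥ 0. Conversely, according
-- to the signs of γ and β − 2γ, one of (0, 0), (0, γ) and (2γ − β, β − γ)
-- solves the system, again with every slack a sum of slacks of the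
-- conditions. These candidates are integer combinations of β and γ, hence
-- rational when β and γ are.

module Submission where

open import Level using (0ℓ)
open import Data.Nat as ℕ using (zero; suc)
open import Data.Integer as ℤ using (+0; +[1+_]; -[1+_]; _⊖_)
import Data.Integer.Properties as ℤ
open import Data.Maybe using (map)
open import Data.Product using (∃₂; _×_; _,_)
open import Data.Sum using (inj₁; inj₂)
open import Function.Bundles using (_⇔_; mk⇔)
open import Relation.Nullary.Decidable using (dec⇒maybe)
open import Relation.Binary.PropositionalEquality
open import Relation.Binary.Structures using (IsTotalOrder)
open import Algebra.Bundles using (CommutativeRing)
open import Algebra.Structures using (IsCommutativeRing)
open import Algebra.Solver.Ring.AlmostCommutativeRing
  using (AlmostCommutativeRing; fromCommutativeRing; _-Raw-AlmostCommutative⟶_)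
import Algebra.Solver.Ring
import Algebra.Properties.AbelianGroup
import Algebra.Properties.CommutativeSemigroup
import Algebra.Properties.Ring
import Algebra.Properties.Semiring.Mult

open import Defs

module _ (R : RealNumbers) where
  open RealNumbers R
  open IsCommutativeRing isCommutativeRing
    using (_-_; +-comm; +-identityˡ; +-identityʳ; -‿inverseʳ; *-identityˡ; zeroˡ; zeroʳ; distribʳ)
  open IsTotalOrder isTotalOrder using (total) renaming (refl to ≤-refl; trans to ≤-trans)
  open ≡-Reasoning

  commutativeRing : CommutativeRing 0ℓ 0ℓ
  commutativeRing = record { isCommutativeRing = isCommutativeRing }

  private
    open CommutativeRing commutativeRing
      using (semiring; ring; +-abelianGroup; +-commutativeSemigroup)
    module Mult = Algebra.Properties.Semiring.Mult semiring
    module Ring = Algebra.Properties.Ring ring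
    module Group = Algebra.Properties.AbelianGroup +-abelianGroup
    module Semigroup = Algebra.Properties.CommutativeSemigroup +-commutativeSemigroup

  fromℕ≡×1# : ∀ n → fromℕ n ≡ n Mult.× 1#
  fromℕ≡×1# zero    = refl
  fromℕ≡×1# (suc n) = cong (1# +_) (fromℕ≡×1# n)

  fromℕ-+ : ∀ m n → fromℕ (m ℕ.+ n) ≡ fromℕ m + fromℕ n
  fromℕ-+ m n rewrite fromℕ≡×1# (m ℕ.+ n) | fromℕ≡×1# m | fromℕ≡×1# n = Mult.×-homo-+ 1# m n

  fromℕ-* : ∀ m n → fromℕ (m ℕ.* n) ≡ fromℕ m * fromℕ n
  fromℕ-* m n rewrite fromℕ≡×1# (m ℕ.* n) | fromℕ≡×1# m | fromℕ≡×1# n = Mult.×1-homo-* m n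

  fromℤ-⊖ : ∀ m n → fromℤ (m ⊖ n) ≡ fromℕ m - fromℕ n
  fromℤ-⊖ m       zero    = sym (trans (cong (fromℕ m +_) Group.ε⁻¹≈ε) (+-identityʳ _))
  fromℤ-⊖ zero    (suc n) = sym (+-identityˡ _)
  fromℤ-⊖ (suc m) (suc n) = begin
    fromℤ (suc m ⊖ suc n)                ≡⟨ cong fromℤ (ℤ.[1+m]⊖[1+n]≡m⊖n m n) ⟩
    fromℤ (m ⊖ n)                        ≡⟨ fromℤ-⊖ m n ⟩
    fromℕ m - fromℕ n                    ≡⟨ +-identityˡ _ ⟨
    0# + (fromℕ m - fromℕ n)             ≡⟨ cong (_+ (fromℕ m - fromℕ n)) (-‿inverseʳ 1#) ⟨
    (1# - 1#) + (fromℕ m - fromℕ n)      ≡⟨ Semigroup.interchange 1# (- 1#) (fromℕ m) (- fromℕ n) ⟩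
    (1# + fromℕ m) + (- 1# + - fromℕ n)  ≡⟨ cong ((1# + fromℕ m) +_) (Group.⁻¹-∙-comm 1# (fromℕ n)) ⟩
    fromℕ (suc m) - fromℕ (suc n)        ∎

  fromℤ-neg : ∀ i → fromℤ (ℤ.- i) ≡ - fromℤ i
  fromℤ-neg -[1+ n ]   = sym (Group.⁻¹-involutive _)
  fromℤ-neg +0         = sym Group.ε⁻¹≈ε
  fromℤ-neg +[1+ n ]   = refl

  fromℤ-+ : ∀ i j → fromℤ (i ℤ.+ j) ≡ fromℤ i + fromℤ j
  fromℤ-+ (ℤ.+ m)  (ℤ.+ n)  = fromℕ-+ m n
  fromℤ-+ (ℤ.+ m)  -[1+ n ] = fromℤ-⊖ m (suc n)
  fromℤ-+ -[1+ m ] (ℤ.+ n)  = trans (fromℤ-⊖ n (suc m)) (+-comm _ _)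
  fromℤ-+ -[1+ m ] -[1+ n ] = begin
    fromℤ (-[1+ m ] ℤ.+ -[1+ n ])        ≡⟨ cong fromℤ (ℤ.neg-distrib-+ +[1+ m ] +[1+ n ]) ⟨
    fromℤ (ℤ.- (+[1+ m ] ℤ.+ +[1+ n ]))  ≡⟨ cong -_ (fromℕ-+ (suc m) (suc n)) ⟩
    - (fromℕ (suc m) + fromℕ (suc n))    ≡⟨ Group.⁻¹-∙-comm _ _ ⟨
    fromℤ -[1+ m ] + fromℤ -[1+ n ]      ∎

  fromℤ-- : ∀ i j → fromℤ (i ℤ.- j) ≡ fromℤ i - fromℤ j
  fromℤ-- i j = trans (fromℤ-+ i (ℤ.- j)) (cong (fromℤ i +_) (fromℤ-neg j))

  fromℤ-+* : ∀ m j → fromℤ (ℤ.+ m ℤ.* j) ≡ fromℕ m * fromℤ j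
  fromℤ-+* zero    j = sym (zeroˡ _)
  fromℤ-+* (suc m) j = begin
    fromℤ (+[1+ m ] ℤ.* j)            ≡⟨ cong fromℤ (ℤ.suc-* (ℤ.+ m) j) ⟩
    fromℤ (j ℤ.+ ℤ.+ m ℤ.* j)         ≡⟨ fromℤ-+ j (ℤ.+ m ℤ.* j) ⟩
    fromℤ j + fromℤ (ℤ.+ m ℤ.* j)     ≡⟨ cong (fromℤ j +_) (fromℤ-+* m j) ⟩
    fromℤ j + fromℕ m * fromℤ j       ≡⟨ cong (_+ fromℕ m * fromℤ j) (*-identityˡ _) ⟨
    1# * fromℤ j + fromℕ m * fromℤ j  ≡⟨ distribʳ _ _ _ ⟨
    fromℕ (suc m) * fromℤ j           ∎

  fromℤ-* : ∀ i j → fromℤ (i ℤ.* j) ≡ fromℤ i * fromℤ j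
  fromℤ-* (ℤ.+ m)  j = fromℤ-+* m j
  fromℤ-* -[1+ m ] j = begin
    fromℤ (-[1+ m ] ℤ.* j)        ≡⟨ cong fromℤ (ℤ.neg-distribˡ-* +[1+ m ] j) ⟨
    fromℤ (ℤ.- (+[1+ m ] ℤ.* j))  ≡⟨ fromℤ-neg (+[1+ m ] ℤ.* j) ⟩
    - fromℤ (+[1+ m ] ℤ.* j)      ≡⟨ cong -_ (fromℤ-+* (suc m) j) ⟩
    - (fromℕ (suc m) * fromℤ j)   ≡⟨ Ring.-‿distribˡ-* _ _ ⟩
    fromℤ -[1+ m ] * fromℤ j      ∎

  almostCommutativeRing : AlmostCommutativeRing 0ℓ 0ℓ
  almostCommutativeRing = fromCommutativeRing commutativeRing

  fromℤ-morphism : ℤ.+-*-rawRing -Raw-AlmostCommutative⟶ almostCommutativeRing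
  fromℤ-morphism = record
    { ⟦_⟧    = fromℤ
    ; +-homo = fromℤ-+
    ; *-homo = fromℤ-*
    ; -‿homo = fromℤ-neg
    ; 0-homo = refl
    ; 1-homo = +-identityʳ 1#
    }

  module ℤ-Solver = Algebra.Solver.Ring ℤ.+-*-rawRing almostCommutativeRing fromℤ-morphism
    (λ i j → map (cong fromℤ) (dec⇒maybe (i ℤ.≟ j)))
  open ℤ-Solver using (solve; _:=_; _:+_; _:-_; _:*_; con; Polynomial)

  :0 :2 :3 : ∀ {n} → Polynomial n
  :0 = con +0
  :2 = con (ℤ.+ 2)
  :3 = con (ℤ.+ 3)

  +-nonneg : ∀ {a b} → 0# ≤ a → 0# ≤ b → 0# ≤ a + b
  +-nonneg {a} {b} 0≤a 0≤b = ≤-trans (subst (0# ≤_) (sym (+-identityˡ b)) 0≤b) (+-mono-≤ b 0≤a)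

  ≤⇒0≤- : ∀ {a b} → a ≤ b → 0# ≤ b - a
  ≤⇒0≤- {a} {b} a≤b = subst (_≤ b - a) (-‿inverseʳ a) (+-mono-≤ (- a) a≤b)

  ≤-by-difference : ∀ {a b e} → b - a ≡ e → 0# ≤ e → a ≤ b
  ≤-by-difference {a} {b} b-a≡e 0≤e = subst₂ _≤_ (+-identityˡ a) e+a≡b (+-mono-≤ a 0≤e)
    where
    e+a≡b : _ + a ≡ b
    e+a≡b = trans (cong (_+ a) (sym b-a≡e)) (solve 2 (λ a b → b :- a :+ a := b) refl a b)

  isRational-0# : IsRational 0#
  isRational-0# = +0 , 0 , zeroʳ _

  isRational-- : ∀ {r s} → IsRational r → IsRational s → IsRational (r - s)
  isRational-- {r} {s} (p , m , Mr≡p) (q , n , Ns≡q) =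
    +[1+ n ] ℤ.* p ℤ.- +[1+ m ] ℤ.* q , n ℕ.+ m ℕ.* suc n , (begin
    fromℕ (suc m ℕ.* suc n) * (r - s)                ≡⟨ cong (_* (r - s)) (fromℕ-* (suc m) (suc n)) ⟩
    M * N * (r - s)                                  ≡⟨ solve 4 (λ M N r s → M :* N :* (r :- s)
                                                                := N :* (M :* r) :- M :* (N :* s)) refl M N r s ⟩
    N * (M * r) - M * (N * s)                        ≡⟨ cong₂ (λ u v → N * u - M * v) Mr≡p Ns≡q ⟩
    N * fromℤ p - M * fromℤ q                        ≡⟨ cong₂ _-_ (fromℤ-+* (suc n) p) (fromℤ-+* (suc m) q) ⟨
    fromℤ (+[1+ n ] ℤ.* p) - fromℤ (+[1+ m ] ℤ.* q)  ≡⟨ fromℤ-- (+[1+ n ] ℤ.* p) (+[1+ m ] ℤ.* q) ⟨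
    fromℤ (+[1+ n ] ℤ.* p ℤ.- +[1+ m ] ℤ.* q)        ∎)
    where
    M N : Carrier
    M = fromℕ (suc m)
    N = fromℕ (suc n)

  system⇒condition : ∀ {α β γ δ x y} → System R α β γ δ x y → Condition R α β γ δ
  system⇒condition {α} {β} {γ} {δ} {x} {y} (2x+y≤α , x+2y≤β , γ≤x+y , x+y≤δ , 0≤x , 0≤y) =
      ≤-by-difference (solve 3 (λ α x y → α :- :0 := (α :- (:2 :* x :+ y)) :+ x :+ x :+ y) refl α x y)
        (+-nonneg (+-nonneg (+-nonneg s₁ 0≤x) 0≤x) 0≤y)
    , ≤-by-difference (solve 3 (λ β x y → β :- :0 := (β :- (x :+ :2 :* y)) :+ x :+ y :+ y) refl β x y)
        (+-nonneg (+-nonneg (+-nonneg s₂ 0≤x) 0≤y) 0≤y)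
    , ≤-by-difference (solve 3 (λ δ x y → δ :- :0 := (δ :- (x :+ y)) :+ x :+ y) refl δ x y)
        (+-nonneg (+-nonneg s₄ 0≤x) 0≤y)
    , ≤-by-difference (solve 4 (λ α γ x y → α :- γ := (α :- (:2 :* x :+ y)) :+ x :+ (x :+ y :- γ))
                         refl α γ x y)
        (+-nonneg (+-nonneg s₁ 0≤x) s₃)
    , ≤-by-difference (solve 4 (λ β γ x y → β :- γ := (β :- (x :+ :2 :* y)) :+ y :+ (x :+ y :- γ))
                         refl β γ x y)
        (+-nonneg (+-nonneg s₂ 0≤y) s₃)
    , ≤-by-difference (solve 4 (λ δ γ x y → δ :- γ := (δ :- (x :+ y)) :+ (x :+ y :- γ)) refl δ γ x y)
        (+-nonneg s₄ s₃)
    , ≤-by-difference (solve 5 (λ α β γ x y → α :+ β :- :3 :* γ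
                                 := (α :- (:2 :* x :+ y)) :+ (β :- (x :+ :2 :* y))
                                    :+ (x :+ y :- γ) :+ (x :+ y :- γ) :+ (x :+ y :- γ))
                         refl α β γ x y)
        (+-nonneg (+-nonneg (+-nonneg (+-nonneg s₁ s₂) s₃) s₃) s₃)
    where
    s₁ : 0# ≤ α - (fromℕ 2 * x + y)
    s₁ = ≤⇒0≤- 2x+y≤α
    s₂ : 0# ≤ β - (x + fromℕ 2 * y)
    s₂ = ≤⇒0≤- x+2y≤β
    s₃ : 0# ≤ x + y - γ
    s₃ = ≤⇒0≤- γ≤x+y
    s₄ : 0# ≤ δ - (x + y)
    s₄ = ≤⇒0≤- x+y≤δ

  origin-solves : ∀ {α β γ δ} → 0# ≤ α → 0# ≤ β → γ ≤ 0# → 0# ≤ δ → System R α β γ δ 0# 0#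
  origin-solves {α} {β} {γ} {δ} 0≤α 0≤β γ≤0 0≤δ =
      ≤-by-difference (solve 1 (λ α → α :- (:2 :* :0 :+ :0) := α) refl α) 0≤α
    , ≤-by-difference (solve 1 (λ β → β :- (:0 :+ :2 :* :0) := β) refl β) 0≤β
    , ≤-by-difference (solve 1 (λ γ → :0 :+ :0 :- γ := :0 :- γ) refl γ) (≤⇒0≤- γ≤0)
    , ≤-by-difference (solve 1 (λ δ → δ :- (:0 :+ :0) := δ) refl δ) 0≤δ
    , ≤-refl
    , ≤-refl

  [0,γ]-solves : ∀ {α β γ δ} → γ ≤ α → fromℕ 2 * γ ≤ β → 0# ≤ γ → γ ≤ δ → System R α β γ δ 0# γ
  [0,γ]-solves {α} {β} {γ} {δ} γ≤α 2γ≤β 0≤γ γ≤δ =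
      ≤-by-difference (solve 2 (λ α γ → α :- (:2 :* :0 :+ γ) := α :- γ) refl α γ) (≤⇒0≤- γ≤α)
    , ≤-by-difference (solve 2 (λ β γ → β :- (:0 :+ :2 :* γ) := β :- :2 :* γ) refl β γ)
        (≤⇒0≤- 2γ≤β)
    , ≤-by-difference (solve 1 (λ γ → :0 :+ γ :- γ := :0) refl γ) ≤-refl
    , ≤-by-difference (solve 2 (λ δ γ → δ :- (:0 :+ γ) := δ :- γ) refl δ γ) (≤⇒0≤- γ≤δ)
    , ≤-refl
    , 0≤γ

  [2γ-β,β-γ]-solves : ∀ {α β γ δ} → fromℕ 3 * γ ≤ α + β → γ ≤ β → γ ≤ δ → β ≤ fromℕ 2 * γ →
                      System R α β γ δ (γ - (β - γ)) (β - γ)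
  [2γ-β,β-γ]-solves {α} {β} {γ} {δ} 3γ≤α+β γ≤β γ≤δ β≤2γ =
      ≤-by-difference (solve 3 (λ α β γ → α :- (:2 :* (γ :- (β :- γ)) :+ (β :- γ)) := α :+ β :- :3 :* γ)
                         refl α β γ)
        (≤⇒0≤- 3γ≤α+β)
    , ≤-by-difference (solve 2 (λ β γ → β :- ((γ :- (β :- γ)) :+ :2 :* (β :- γ)) := :0) refl β γ)
        ≤-refl
    , ≤-by-difference (solve 2 (λ β γ → (γ :- (β :- γ)) :+ (β :- γ) :- γ := :0) refl β γ) ≤-refl
    , ≤-by-difference (solve 3 (λ δ β γ → δ :- ((γ :- (β :- γ)) :+ (β :- γ)) := δ :- γ) refl δ β γ)
        (≤⇒0≤- γ≤δ)
    , ≤-by-difference (solve 2 (λ β γ → γ :- (β :- γ) :- :0 := :2 :* γ :- β) refl β γ)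
        (≤⇒0≤- β≤2γ)
    , ≤-by-difference (solve 2 (λ β γ → β :- γ :- :0 := β :- γ) refl β γ) (≤⇒0≤- γ≤β)

  condition⇒solution : ∀ {α β γ δ} → Condition R α β γ δ →
    ∃₂ λ x y → (IsRational β → IsRational γ → IsRational x × IsRational y) × System R α β γ δ x y
  condition⇒solution {α} {β} {γ} {δ} (0≤α , 0≤β , 0≤δ , γ≤α , γ≤β , γ≤δ , 3γ≤α+β)
    with total γ 0# | total (fromℕ 2 * γ) β
  ... | inj₁ γ≤0 | _ =
    0# , 0# , (λ _ _ → isRational-0# , isRational-0#) , origin-solves 0≤α 0≤β γ≤0 0≤δ
  ... | inj₂ 0≤γ | inj₁ 2γ≤β =
    0# , γ , (λ _ ℚγ → isRational-0# , ℚγ) , [0,γ]-solves γ≤α 2γ≤β 0≤γ γ≤δ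
  ... | inj₂ _   | inj₂ β≤2γ =
    γ - (β - γ) , β - γ , (λ ℚβ ℚγ → let ℚy = isRational-- ℚβ ℚγ in isRational-- ℚγ ℚy , ℚy) ,
    [2γ-β,β-γ]-solves 3γ≤α+β γ≤β γ≤δ β≤2γ

mainTheorem17 : (R : RealNumbers) → (α β γ δ : RealNumbers.Carrier R) →
    ((∃₂ λ x y → System R α β γ δ x y) ⇔ Condition R α β γ δ) ×
    (RealNumbers.IsRational R α → RealNumbers.IsRational R β → RealNumbers.IsRational R γ →
      (∃₂ λ x y → System R α β γ δ x y) →
      ∃₂ λ x y → RealNumbers.IsRational R x × RealNumbers.IsRational R y × System R α β γ δ x y)
mainTheorem17 R α β γ δ =
    mk⇔ (λ (_ , _ , system) → system⇒condition R system)
        (λ condition → let (x , y , _ , system) = condition⇒solution R condition in x , y , system)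
  , λ _ ℚβ ℚγ (_ , _ , system) →
      let (x , y , rational , system′) = condition⇒solution R (system⇒condition R system)
          (ℚx , ℚy) = rational ℚβ ℚγ
      in x , y , ℚx , ℚy , system′
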